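{- Let $r\ge1$ be an integer and let $\mathcal{H}=\{H_1,\dots,H_m\}$ ($m\ge1$) be a non-empty finite family of non-empty $r$-uniform hypergraphs. Then, as $n\to\infty$, \[\mathrm{wsat}(n,\mathcal{H})=\mathrm{wsat}\Big(n,\bigsqcup_{H\in\mathcal{H}}H\Big)+\Theta(1).\]
   Context: An $r$-uniform hypergraph has a finite vertex set and edges that are $r$-element subsets of it; it is non-empty if it has at least one edge. $K_n^r$ is the complete $r$-uniform hypergraph on $n$ vertices. For a non-empty family $\mathcal{H}$ of non-empty $r$-uniform hypergraphs, an $r$-uniform hypergraph $F$ on $n$ vertices is weakly $\mathcal{H}$-saturated if the edges of $E(K_n^r)\setminus E(F)$ can be ordered $e_1,\dots,e_k$ so that for each $i$ there is $H\in\mathcal{H}$ such that $F\cup\{e_1,\dots,e_i\}$ contains a copy of $H$ containing $e_i$; $\mathrm{wsat}(n,\mathcal{H})$ is the minimum number of edges of such an $F$ (for a single hypergraph $H$, $\mathrm{wsat}(n,H)=\mathrm{wsat}(n,\{H\})$). The disjoint union $\bigsqcup_{i\in[m]}H_i$ is the hypergraph with vertex set $\bigcup_{i}V(H_i)\times\{i\}$ and edge set $\bigcup_i\{e\times\{i\}: e\in E(H_i)\}$. -}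

module Defs where

open import Data.Nat using (ℕ; zero; suc; _+_)
open import Data.Fin using (Fin)
open import Data.Fin.Subset using (Subset; ∣_∣; outside) renaming (_∈_ to _∈ₛ_)
open import Data.Vec using (Vec; _++_; replicate)
open import Data.List using (List; []; _∷_; map; length) renaming (_++_ to _++ₗ_)
open import Data.List.Membership.Propositional using (_∈_; _∉_)
open import Data.List.Relation.Unary.All using (All)
open import Data.List.Relation.Unary.Any using (Any)
open import Data.List.Relation.Unary.Unique.Propositional using (Unique)
open import Data.Product using (Σ; ∃; _×_; ∃-syntax)
open import Data.Sum using (_⊎_)
open import Data.Unit using (⊤)
open import Function.Bundles using (_⇔_)
open import Function.Definitions using (Injective)
open import Relation.Binary.PropositionalEquality using (_≡_; _≢_)

record Hypergraph : Set where
  constructor hg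
  field
    vertices : ℕ
    edges    : List (Subset vertices)
open Hypergraph public

IsUniform : ℕ → Hypergraph → Set
IsUniform r H = All (λ s → ∣ s ∣ ≡ r) (edges H) × Unique (edges H)

NonEmpty : Hypergraph → Set
NonEmpty H = edges H ≢ []

MapsTo : ∀ {k n} → (Fin k → Fin n) → Subset k → Subset n → Set
MapsTo {k} φ s t = ∀ j → (j ∈ₛ t) ⇔ (∃[ i ] (i ∈ₛ s × φ i ≡ j))

CopyContaining : ∀ {n} → Hypergraph → List (Subset n) → Subset n → Set
CopyContaining {n} H G e =
  Σ (Fin (vertices H) → Fin n) λ φ →
    Injective _≡_ _≡_ φ
    × All (λ s → Any (λ t → MapsTo φ s t) G) (edges H)
    × Any (λ s → MapsTo φ s e) (edges H)

Process : ∀ {n} → List Hypergraph → List (Subset n) → List (Subset n) → Set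
Process ℋ F [] = ⊤
Process ℋ F (e ∷ L) =
  Any (λ H → CopyContaining H (e ∷ F) e) ℋ × Process ℋ (e ∷ F) L

WeaklySat : (r n : ℕ) → List Hypergraph → List (Subset n) → Set
WeaklySat r n ℋ F =
  All (λ s → ∣ s ∣ ≡ r) F × Unique F ×
  Σ (List (Subset n)) λ L →
    -- L is an ordering of E(K_n^r) \ E(F)
    Unique L × All (λ s → ∣ s ∣ ≡ r) L × All (λ s → s ∉ F) L
    × (∀ (s : Subset n) → ∣ s ∣ ≡ r → s ∈ F ⊎ s ∈ L)
    × Process ℋ F L

IsWsat : ℕ → ℕ → List Hypergraph → ℕ → Set
IsWsat r n ℋ w =
  (Σ (List (Subset n)) λ F → WeaklySat r n ℋ F × length F ≡ w)
  × (∀ (F : List (Subset n)) → WeaklySat r n ℋ F → w Data.Nat.≤ length F)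

_⊔_ : Hypergraph → Hypergraph → Hypergraph
hg k E ⊔ hg k' E' =
  hg (k + k') (map (λ s → s ++ replicate k' outside) E
               ++ₗ map (λ s → replicate k outside ++ s) E')

emptyHG : Hypergraph
emptyHG = hg 0 []

⨆ : List Hypergraph → Hypergraph
⨆ [] = emptyHG
⨆ (H ∷ Hs) = H ⊔ ⨆ Hs

{-# OPTIONS --safe #-}
module Submission where

-- A copy of ⨆ ℋ containing a new edge e restricts to a copy of some member of ℋ containing e,
-- so every weakly ⨆ ℋ-saturated graph is weakly ℋ-saturated. Conversely, add to a weakly
-- ℋ-saturated F the C edges of |V(⨆ ℋ)| + 1 vertex-disjoint copies of ⨆ ℋ. When the
-- ℋ-process adds e through a copy of some H ∈ ℋ, that copy has at most |V(⨆ ℋ)| vertices and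
-- so misses one of these spare copies entirely; replacing the H-component of that spare copy
-- by the copy of H yields a copy of ⨆ ℋ containing e. Hence the enlarged graph is weakly
-- ⨆ ℋ-saturated, and the two saturation numbers differ by at most C.

open import Defs
open import Data.Bool using () renaming (_≟_ to _≟ᵇ_)
open import Data.Empty using (⊥-elim)
open import Data.Fin using (Fin; zero; suc; _↑ˡ_; _↑ʳ_; splitAt)
open import Data.Fin.Properties
  using (↑ˡ-injective; ↑ʳ-injective; splitAt-↑ˡ; splitAt-↑ʳ; any?; ¬∀⟶∃¬; pigeonhole; <⇒≢)
  renaming (_≟_ to _≟ᶠ_)
open import Data.Fin.Subset using (Subset; ∣_∣; outside; inside) renaming (_∈_ to _∈ₛ_; ⊥ to ∅)
open import Data.Fin.Subset.Properties using (∉⊥; ∣⊥∣≡0)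
open import Data.List using (List; []; _∷_; [_]; map; length; replicate; filter; deduplicate)
  renaming (_++_ to _++ₗ_)
open import Data.List.Properties using (length-++; length-map; length-deduplicate)
open import Data.List.Membership.Propositional using (_∈_; find; lose)
open import Data.List.Membership.Propositional.Properties
  using (∈-map⁺; ∈-++⁺ˡ; ∈-++⁺ʳ; ∈-filter⁺; ∈-deduplicate⁺)
open import Data.List.Relation.Binary.Subset.Propositional using (_⊆_)
open import Data.List.Relation.Binary.Subset.Propositional.Properties
  using (Any-resp-⊆; ∷⁺ʳ; ∈-∷⁺ʳ; xs⊆xs++ys; xs⊆ys++xs)
open import Data.List.Relation.Unary.All as All using (All; []; _∷_)
import Data.List.Relation.Unary.All.Properties as All
open import Data.List.Relation.Unary.Any as Any using (Any; here; there)
import Data.List.Relation.Unary.Any.Properties as Any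
open import Data.List.Relation.Unary.Unique.Propositional using (Unique)
import Data.List.Relation.Unary.Unique.Propositional.Properties as Unique
open import Data.List.Relation.Unary.Unique.DecPropositional.Properties using (deduplicate-!)
open import Data.Nat using (ℕ; zero; suc; _+_; _≤_; _<_; s≤s)
open import Data.Nat.Properties
  using (module ≤-Reasoning; ≤-trans; m≤m+n; m≤n+m; +-identityʳ; m≤n⇒∃[o]m+o≡n)
open import Data.Product using (Σ; ∃; ∃₂; _×_; _,_; proj₁; ∃-syntax)
import Data.Product as Product
open import Data.Sum using (_⊎_; inj₁; inj₂; [_,_]′)
import Data.Sum as Sum
open import Data.Unit using (tt)
open import Data.Vec using (_++_)
import Data.Vec as Vec
open import Data.Vec.Properties using (lookup-++ˡ; lookup-++ʳ; []=⇒lookup; lookup⇒[]=; ≡-dec)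
open import Function using (_∘_; _⇔_; mk⇔; Injective)
open import Function.Bundles using (module Equivalence)
import Function.Properties.Equivalence as ⇔
open import Relation.Binary.Definitions using (DecidableEquality)
open import Relation.Binary.PropositionalEquality
  using (_≡_; _≢_; refl; sym; trans; cong; cong₂; subst; module ≡-Reasoning)
open import Relation.Nullary using (¬_; yes; no)
open import Relation.Unary using (Decidable)

open Equivalence using (to; from)

data Split (k k' : ℕ) : Fin (k + k') → Set where
  left  : (a : Fin k)  → Split k k' (a ↑ˡ k')
  right : (b : Fin k') → Split k k' (k ↑ʳ b)

split : ∀ k {k'} (i : Fin (k + k')) → Split k k' i
split zero    i       = right i
split (suc k) zero    = left zero
split (suc k) (suc i) with split k i
... | left a  = left (suc a)
... | right b = right b

↑ˡ≢↑ʳ : ∀ k {k'} (a : Fin k) (b : Fin k') → a ↑ˡ k' ≢ k ↑ʳ b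
↑ˡ≢↑ʳ k {k'} a b eq with trans (sym (splitAt-↑ˡ k a k')) (trans (cong (splitAt k) eq) (splitAt-↑ʳ k k' b))
... | ()

module _ {A : Set} {k k' : ℕ} where

  _⊕_ : (Fin k → A) → (Fin k' → A) → Fin (k + k') → A
  φ ⊕ φ' = [ φ , φ' ]′ ∘ splitAt k

  ⊕-↑ˡ : ∀ (φ : Fin k → A) (φ' : Fin k' → A) a → (φ ⊕ φ') (a ↑ˡ k') ≡ φ a
  ⊕-↑ˡ φ φ' a = cong [ φ , φ' ]′ (splitAt-↑ˡ k a k')

  ⊕-↑ʳ : ∀ (φ : Fin k → A) (φ' : Fin k' → A) b → (φ ⊕ φ') (k ↑ʳ b) ≡ φ' b
  ⊕-↑ʳ φ φ' b = cong [ φ , φ' ]′ (splitAt-↑ʳ k k' b)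

  ⊕-cases : ∀ (φ : Fin k → A) (φ' : Fin k' → A) i →
            (∃ λ a → (φ ⊕ φ') i ≡ φ a) ⊎ (∃ λ b → (φ ⊕ φ') i ≡ φ' b)
  ⊕-cases φ φ' i with split k i
  ... | left a  = inj₁ (a , ⊕-↑ˡ φ φ' a)
  ... | right b = inj₂ (b , ⊕-↑ʳ φ φ' b)

  ⊕-injective : ∀ {φ : Fin k → A} {φ' : Fin k' → A} → Injective _≡_ _≡_ φ → Injective _≡_ _≡_ φ' →
                (∀ a b → φ a ≢ φ' b) → Injective _≡_ _≡_ (φ ⊕ φ')
  ⊕-injective {φ} {φ'} φ-inj φ'-inj disjoint {i} {j} eq with split k i | split k j
  ... | left a  | left a'  = cong (_↑ˡ k') (φ-inj (trans (sym (⊕-↑ˡ φ φ' a)) (trans eq (⊕-↑ˡ φ φ' a'))))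
  ... | left a  | right b' = ⊥-elim (disjoint a b' (trans (sym (⊕-↑ˡ φ φ' a)) (trans eq (⊕-↑ʳ φ φ' b'))))
  ... | right b | left a'  = ⊥-elim (disjoint a' b (trans (sym (⊕-↑ˡ φ φ' a')) (trans (sym eq) (⊕-↑ʳ φ φ' b))))
  ... | right b | right b' = cong (k ↑ʳ_) (φ'-inj (trans (sym (⊕-↑ʳ φ φ' b)) (trans eq (⊕-↑ʳ φ φ' b'))))

module _ {k k' : ℕ} {s : Subset k} {t : Subset k'} where

  ∈-++ˡ : ∀ {a} → (a ↑ˡ k') ∈ₛ (s ++ t) ⇔ a ∈ₛ s
  ∈-++ˡ {a} = mk⇔ (λ h → lookup⇒[]= a s (trans (sym (lookup-++ˡ s t a)) ([]=⇒lookup h)))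
                  (λ h → lookup⇒[]= _ (s ++ t) (trans (lookup-++ˡ s t a) ([]=⇒lookup h)))

  ∈-++ʳ : ∀ {b} → (k ↑ʳ b) ∈ₛ (s ++ t) ⇔ b ∈ₛ t
  ∈-++ʳ {b} = mk⇔ (λ h → lookup⇒[]= b t (trans (sym (lookup-++ʳ s t b)) ([]=⇒lookup h)))
                  (λ h → lookup⇒[]= _ (s ++ t) (trans (lookup-++ʳ s t b) ([]=⇒lookup h)))

∣++∣ : ∀ {k k'} (s : Subset k) (t : Subset k') → ∣ s ++ t ∣ ≡ ∣ s ∣ + ∣ t ∣
∣++∣ Vec.[]            t = refl
∣++∣ (inside Vec.∷ s)  t = cong suc (∣++∣ s t)
∣++∣ (outside Vec.∷ s) t = ∣++∣ s t

∣++∅∣ : ∀ {k} k' (s : Subset k) → ∣ s ++ ∅ {k'} ∣ ≡ ∣ s ∣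
∣++∅∣ k' s = trans (∣++∣ s ∅) (trans (cong (∣ s ∣ +_) (∣⊥∣≡0 k')) (+-identityʳ _))

∣∅++∣ : ∀ {k'} k (s : Subset k') → ∣ ∅ {k} ++ s ∣ ≡ ∣ s ∣
∣∅++∣ k s = trans (∣++∣ (∅ {k}) s) (cong (_+ ∣ s ∣) (∣⊥∣≡0 k))

Image : ∀ {k n} → (Fin k → Fin n) → Subset k → Fin n → Set
Image φ s j = ∃[ i ] (i ∈ₛ s × φ i ≡ j)

module _ {k m n : ℕ} {φ : Fin k → Fin m} {s : Subset k} {t : Subset m} where

  Image-∘ : ∀ {ι : Fin m → Fin n} → MapsTo φ s t → ∀ j → Image ι t j ⇔ Image (ι ∘ φ) s j
  Image-∘ {ι} φst j = mk⇔
    (λ (y , y∈t , ιy≡j) → let (i , i∈s , φi≡y) = to (φst y) y∈t in i , i∈s , trans (cong ι φi≡y) ιy≡j)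
    (λ (i , i∈s , ιφi≡j) → φ i , from (φst (φ i)) (i , i∈s , refl) , ιφi≡j)

  MapsTo-∘ : ∀ {ι : Fin m → Fin n} {u} → MapsTo φ s t → MapsTo ι t u → MapsTo (ι ∘ φ) s u
  MapsTo-∘ φst ιtu j = ⇔.trans (ιtu j) (Image-∘ φst j)

  MapsTo-∘⁻ : ∀ {ι : Fin m → Fin n} {u} → MapsTo φ s t → MapsTo (ι ∘ φ) s u → MapsTo ι t u
  MapsTo-∘⁻ φst ιφsu j = ⇔.trans (ιφsu j) (⇔.sym (Image-∘ φst j))

MapsTo-cong : ∀ {k n} {φ ψ : Fin k → Fin n} {s t} → (∀ i → φ i ≡ ψ i) → MapsTo φ s t → MapsTo ψ s t
MapsTo-cong φ≗ψ φst j = ⇔.trans (φst j) (mk⇔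
  (λ (i , i∈s , φi≡j) → i , i∈s , trans (sym (φ≗ψ i)) φi≡j)
  (λ (i , i∈s , ψi≡j) → i , i∈s , trans (φ≗ψ i) ψi≡j))

MapsTo-↑ˡ : ∀ {k} k' (s : Subset k) → MapsTo (_↑ˡ k') s (s ++ ∅ {k'})
MapsTo-↑ˡ {k} k' s j with split k j
... | left a  = mk⇔ (λ a∈ → a , to ∈-++ˡ a∈ , refl)
                    (λ (a' , a'∈s , eq) → from ∈-++ˡ (subst (_∈ₛ s) (↑ˡ-injective k' _ _ eq) a'∈s))
... | right b = mk⇔ (λ b∈ → ⊥-elim (∉⊥ (to (∈-++ʳ {s = s}) b∈)))
                    (λ (a , _ , eq) → ⊥-elim (↑ˡ≢↑ʳ k a b eq))

MapsTo-↑ʳ : ∀ {k'} k (s : Subset k') → MapsTo (k ↑ʳ_) s (∅ {k} ++ s)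
MapsTo-↑ʳ k s j with split k j
... | left a  = mk⇔ (λ a∈ → ⊥-elim (∉⊥ (to (∈-++ˡ {t = s}) a∈)))
                    (λ (b , _ , eq) → ⊥-elim (↑ˡ≢↑ʳ k a b (sym eq)))
... | right b = mk⇔ (λ b∈ → b , to ∈-++ʳ b∈ , refl)
                    (λ (b' , b'∈s , eq) → from ∈-++ʳ (subst (_∈ₛ s) (↑ʳ-injective k _ _ eq) b'∈s))

Embeds : ∀ {n} (H : Hypergraph) → List (Subset n) → (Fin (vertices H) → Fin n) → Set
Embeds H G φ = Injective _≡_ _≡_ φ × All (λ s → Any (MapsTo φ s) G) (edges H)

Covers : ∀ {n} (H : Hypergraph) → (Fin (vertices H) → Fin n) → Subset n → Set
Covers H φ e = Any (λ s → MapsTo φ s e) (edges H)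

copy : ∀ {n} {H} {G : List (Subset n)} {φ e} → Embeds H G φ → Covers H φ e → CopyContaining H G e
copy {φ = φ} (φ-inj , φ-edges) φ-covers = φ , φ-inj , φ-edges , φ-covers

Embeds-∘ : ∀ {n} {H K} {G : List (Subset n)} {ι φ} →
           Embeds K G ι → Embeds H (edges K) φ → Embeds H G (ι ∘ φ)
Embeds-∘ {K = K} {G} {ι} {φ} (ι-inj , ι-edges) (φ-inj , φ-edges) = φ-inj ∘ ι-inj , All.map image-edge φ-edges
  where
  image-edge : ∀ {s} → Any (MapsTo φ s) (edges K) → Any (MapsTo (ι ∘ φ) s) G
  image-edge φs with t , t∈K , φst ← find φs = Any.map (MapsTo-∘ φst) (All.lookup ι-edges t∈K)

Embeds-mono : ∀ {n} {H} {G G' : List (Subset n)} {φ} → G ⊆ G' → Embeds H G φ → Embeds H G' φ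
Embeds-mono G⊆G' = Product.map₂ (All.map (Any-resp-⊆ G⊆G'))

CopyContaining-mono : ∀ {n} {H} {G G' : List (Subset n)} {e} →
                      G ⊆ G' → CopyContaining H G e → CopyContaining H G' e
CopyContaining-mono G⊆G' (φ , φ-inj , φ-edges , φ-covers) = copy (Embeds-mono G⊆G' (φ-inj , φ-edges)) φ-covers

module _ (H H' : Hypergraph) where

  private
    k  = vertices H
    k' = vertices H'

  ↑ˡ-embeds : Embeds H (edges (H ⊔ H')) (_↑ˡ k')
  ↑ˡ-embeds = ↑ˡ-injective k' _ _ , All.tabulate λ s∈H → lose (∈-++⁺ˡ (∈-map⁺ _ s∈H)) (MapsTo-↑ˡ k' _)

  ↑ʳ-embeds : Embeds H' (edges (H ⊔ H')) (k ↑ʳ_)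
  ↑ʳ-embeds = ↑ʳ-injective k _ _ , All.tabulate λ s∈H' → lose (∈-++⁺ʳ _ (∈-map⁺ _ s∈H')) (MapsTo-↑ʳ k _)

  Covers-⊔⁻ : ∀ {n} {ψ : Fin (k + k') → Fin n} {e} →
              Covers (H ⊔ H') ψ e → Covers H (ψ ∘ (_↑ˡ k')) e ⊎ Covers H' (ψ ∘ (k ↑ʳ_)) e
  Covers-⊔⁻ ψ-covers = Sum.map (Any.map (MapsTo-∘ (MapsTo-↑ˡ k' _)) ∘ Any.map⁻)
                               (Any.map (MapsTo-∘ (MapsTo-↑ʳ k _)) ∘ Any.map⁻)
                               (Any.++⁻ _ ψ-covers)

  module _ {n} {φ : Fin k → Fin n} {φ' : Fin k' → Fin n} where

    MapsTo-⊕ˡ : ∀ {s t} → MapsTo φ s t → MapsTo (φ ⊕ φ') (s ++ ∅ {k'}) t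
    MapsTo-⊕ˡ φst = MapsTo-∘⁻ (MapsTo-↑ˡ k' _) (MapsTo-cong (sym ∘ ⊕-↑ˡ φ φ') φst)

    MapsTo-⊕ʳ : ∀ {s t} → MapsTo φ' s t → MapsTo (φ ⊕ φ') (∅ {k} ++ s) t
    MapsTo-⊕ʳ φ'st = MapsTo-∘⁻ (MapsTo-↑ʳ k _) (MapsTo-cong (sym ∘ ⊕-↑ʳ φ φ') φ'st)

    Covers-⊔⁺ˡ : ∀ {e} → Covers H φ e → Covers (H ⊔ H') (φ ⊕ φ') e
    Covers-⊔⁺ˡ = Any.++⁺ˡ ∘ Any.map⁺ ∘ Any.map MapsTo-⊕ˡ

    Covers-⊔⁺ʳ : ∀ {e} → Covers H' φ' e → Covers (H ⊔ H') (φ ⊕ φ') e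
    Covers-⊔⁺ʳ = Any.++⁺ʳ _ ∘ Any.map⁺ ∘ Any.map MapsTo-⊕ʳ

    Embeds-⊔ : ∀ {G : List (Subset n)} → Embeds H G φ → Embeds H' G φ' → (∀ a b → φ a ≢ φ' b) →
               Embeds (H ⊔ H') G (φ ⊕ φ')
    Embeds-⊔ (φ-inj , φ-edges) (φ'-inj , φ'-edges) disjoint =
      ⊕-injective φ-inj φ'-inj disjoint ,
      All.++⁺ (All.map⁺ (All.map (Any.map MapsTo-⊕ˡ) φ-edges))
              (All.map⁺ (All.map (Any.map MapsTo-⊕ʳ) φ'-edges))

  CopyContaining-⊔⁻ : ∀ {n} {G : List (Subset n)} {e} →
                      CopyContaining (H ⊔ H') G e → CopyContaining H G e ⊎ CopyContaining H' G e
  CopyContaining-⊔⁻ (ψ , ψ-inj , ψ-edges , ψ-covers) =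
    Sum.map (copy (Embeds-∘ (ψ-inj , ψ-edges) ↑ˡ-embeds))
            (copy (Embeds-∘ (ψ-inj , ψ-edges) ↑ʳ-embeds))
            (Covers-⊔⁻ ψ-covers)

Completes : ∀ {n} → List Hypergraph → List (Subset n) → Subset n → Set
Completes ℋ G e = Any (λ H → CopyContaining H G e) ℋ

CopyContaining-⨆⁻ : ∀ {n} {G : List (Subset n)} {e} ℋ → CopyContaining (⨆ ℋ) G e → Completes ℋ G e
CopyContaining-⨆⁻ []      (_ , _ , _ , ())
CopyContaining-⨆⁻ (H ∷ ℋ) c = [ here , there ∘ CopyContaining-⨆⁻ ℋ ]′ (CopyContaining-⊔⁻ H (⨆ ℋ) c)

-- The image invariant is what keeps the untouched components disjoint from the recursive copy.
replace-component : ∀ {n} {G : List (Subset n)} {e} {ℋ H} {φ : Fin (vertices H) → Fin n} {g} →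
  H ∈ ℋ → Embeds H G φ → Covers H φ e → Embeds (⨆ ℋ) G g → (∀ x y → φ x ≢ g y) →
  Σ (Fin (vertices (⨆ ℋ)) → Fin n) λ ψ → Embeds (⨆ ℋ) G ψ × Covers (⨆ ℋ) ψ e
    × ∀ i → (∃ λ x → ψ i ≡ φ x) ⊎ (∃ λ y → ψ i ≡ g y)
replace-component {n} {ℋ = H ∷ ℋ} {φ = φ} {g} (here refl) φ-embeds φ-covers g-embeds disjoint =
  φ ⊕ gʳ ,
  Embeds-⊔ H (⨆ ℋ) φ-embeds (Embeds-∘ g-embeds (↑ʳ-embeds H (⨆ ℋ))) (λ x y → disjoint x (_ ↑ʳ y)) ,
  Covers-⊔⁺ˡ H (⨆ ℋ) φ-covers ,
  Sum.map₂ (Product.map (_ ↑ʳ_) λ eq → eq) ∘ ⊕-cases φ gʳ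
  where
  gʳ : Fin (vertices (⨆ ℋ)) → Fin n
  gʳ = g ∘ (vertices H ↑ʳ_)
replace-component {n} {ℋ = H' ∷ ℋ} {φ = φ} {g} (there H∈ℋ) φ-embeds φ-covers g-embeds@(g-inj , _) disjoint
  with replace-component H∈ℋ φ-embeds φ-covers (Embeds-∘ g-embeds (↑ʳ-embeds H' (⨆ ℋ)))
                         (λ x y → disjoint x (_ ↑ʳ y))
... | ψ , ψ-embeds , ψ-covers , ψ-image =
  gˡ ⊕ ψ ,
  Embeds-⊔ H' (⨆ ℋ) (Embeds-∘ g-embeds (↑ˡ-embeds H' (⨆ ℋ))) ψ-embeds gˡ-disjoint ,
  Covers-⊔⁺ʳ H' (⨆ ℋ) ψ-covers ,
  image
  where
  gˡ : Fin (vertices H') → Fin n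
  gˡ = g ∘ (_↑ˡ vertices (⨆ ℋ))
  gˡ-disjoint : ∀ a b → gˡ a ≢ ψ b
  gˡ-disjoint a b gˡa≡ψb with ψ-image b
  ... | inj₁ (x , ψb≡φx) = disjoint x (a ↑ˡ _) (sym (trans gˡa≡ψb ψb≡φx))
  ... | inj₂ (y , ψb≡gʳy) = ↑ˡ≢↑ʳ _ a y (g-inj (trans gˡa≡ψb ψb≡gʳy))
  image : ∀ i → (∃ λ x → (gˡ ⊕ ψ) i ≡ φ x) ⊎ (∃ λ y → (gˡ ⊕ ψ) i ≡ g y)
  image i with ⊕-cases gˡ ψ i
  ... | inj₁ (a , eq) = inj₂ (a ↑ˡ _ , eq)
  ... | inj₂ (b , eq) with ψ-image b
  ...   | inj₁ (x , ψb≡φx) = inj₁ (x , trans eq ψb≡φx)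
  ...   | inj₂ (y , ψb≡gʳy) = inj₂ (_ ↑ʳ y , trans eq ψb≡gʳy)

vertices-≤-⨆ : ∀ {ℋ H} → H ∈ ℋ → vertices H ≤ vertices (⨆ ℋ)
vertices-≤-⨆ {H ∷ ℋ} (here refl)  = m≤m+n _ _
vertices-≤-⨆ {H ∷ ℋ} (there H∈ℋ) = ≤-trans (vertices-≤-⨆ H∈ℋ) (m≤n+m _ _)

module _ (X : Hypergraph) where

  inCopy : ∀ {B} → Fin B → Fin (vertices X) → Fin (vertices (⨆ (replicate B X)))
  inCopy zero    = _↑ˡ _
  inCopy (suc b) = (vertices X ↑ʳ_) ∘ inCopy b

  inCopy-embeds : ∀ {B} (b : Fin B) → Embeds X (edges (⨆ (replicate B X))) (inCopy b)
  inCopy-embeds zero    = ↑ˡ-embeds X _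
  inCopy-embeds (suc b) = Embeds-∘ (↑ʳ-embeds X _) (inCopy-embeds b)

  inCopy-disjoint : ∀ {B} {b b' : Fin B} x y → inCopy b x ≡ inCopy b' y → b ≡ b'
  inCopy-disjoint {b = zero}  {zero}   x y eq = refl
  inCopy-disjoint {b = zero}  {suc b'} x y eq = ⊥-elim (↑ˡ≢↑ʳ _ x _ eq)
  inCopy-disjoint {b = suc b} {zero}   x y eq = ⊥-elim (↑ˡ≢↑ʳ _ y _ (sym eq))
  inCopy-disjoint {b = suc b} {suc b'} x y eq = cong suc (inCopy-disjoint x y (↑ʳ-injective _ _ _ eq))

-- If φ met every block, then (pigeonhole, v < B) two blocks would be met at the same vertex of φ.
avoided-block : ∀ {v B k n} (φ : Fin v → Fin n) (β : Fin B → Fin k → Fin n) →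
                (∀ {b b'} x y → β b x ≡ β b' y → b ≡ b') → v < B → ∃[ b ] ∀ x y → φ x ≢ β b y
avoided-block {v} {B} φ β β-disjoint v<B =
  Product.map₂ (λ ¬hit x y eq → ¬hit (x , y , eq)) (¬∀⟶∃¬ B Hit hit? not-all-hit)
  where
  open ≡-Reasoning
  Hit : Fin B → Set
  Hit b = ∃₂ λ x y → φ x ≡ β b y
  hit? : Decidable Hit
  hit? b = any? λ x → any? λ y → φ x ≟ᶠ β b y
  not-all-hit : ¬ (∀ b → Hit b)
  not-all-hit hit =
    let (i , j , i<j , xᵢ≡xⱼ) = pigeonhole v<B (proj₁ ∘ hit)
        (xᵢ , yᵢ , φxᵢ≡βiyᵢ) = hit i
        (xⱼ , yⱼ , φxⱼ≡βjyⱼ) = hit j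
    in <⇒≢ i<j (β-disjoint yᵢ yⱼ (begin
         β i yᵢ ≡⟨ sym φxᵢ≡βiyᵢ ⟩
         φ xᵢ   ≡⟨ cong φ xᵢ≡xⱼ ⟩
         φ xⱼ   ≡⟨ φxⱼ≡βjyⱼ ⟩
         β j yⱼ ∎))

AllOfSize : ℕ → ∀ {n} → List (Subset n) → Set
AllOfSize r = All (λ s → ∣ s ∣ ≡ r)

AllOfSize-⊔ : ∀ {r} H H' → AllOfSize r (edges H) → AllOfSize r (edges H') → AllOfSize r (edges (H ⊔ H'))
AllOfSize-⊔ H H' H-size H'-size =
  All.++⁺ (All.map⁺ (All.map (λ {s} → trans (∣++∅∣ (vertices H') s)) H-size))
          (All.map⁺ (All.map (λ {s} → trans (∣∅++∣ (vertices H) s)) H'-size))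

AllOfSize-⨆ : ∀ {r} ℋ → All (AllOfSize r ∘ edges) ℋ → AllOfSize r (edges (⨆ ℋ))
AllOfSize-⨆ []      []                 = []
AllOfSize-⨆ (H ∷ ℋ) (H-size ∷ ℋ-sizes) = AllOfSize-⊔ H (⨆ ℋ) H-size (AllOfSize-⨆ ℋ ℋ-sizes)

length-edges-⊔ : ∀ H H' → length (edges (H ⊔ H')) ≡ length (edges H) + length (edges H')
length-edges-⊔ H H' = trans (length-++ (map _ (edges H)))
                            (cong₂ _+_ (length-map _ (edges H)) (length-map _ (edges H')))

_≟ₛ_ : ∀ {n} → DecidableEquality (Subset n)
_≟ₛ_ = ≡-dec _≟ᵇ_

module _ {n : ℕ} where

  open import Data.List.Membership.DecPropositional (_≟ₛ_ {n}) using (_∈?_; _∉?_)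

  Process-transfer : ∀ {ℋ ℋ'} (F' : List (Subset n)) →
    (∀ {G e} → F' ⊆ G → Completes ℋ (e ∷ G) e → Completes ℋ' (e ∷ G) e) →
    ∀ {F G} L → F ⊆ G → F' ⊆ G → Process ℋ F L → Process ℋ' G (filter (_∉? F') L)
  Process-transfer F' step []      _   _    _ = tt
  Process-transfer F' step (e ∷ L) F⊆G F'⊆G (e-step , L-process) with e ∈? F'
  ... | yes e∈F' = Process-transfer F' step L (∈-∷⁺ʳ (F'⊆G e∈F') F⊆G) F'⊆G L-process
  ... | no  _    = step F'⊆G (Any.map (CopyContaining-mono (∷⁺ʳ e F⊆G)) e-step) ,
                   Process-transfer F' step L (∷⁺ʳ e F⊆G) (there ∘ F'⊆G) L-process

  WeaklySat-extend : ∀ {r ℋ ℋ'} {F F' : List (Subset n)} →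
    (∀ {G e} → F' ⊆ G → Completes ℋ (e ∷ G) e → Completes ℋ' (e ∷ G) e) →
    AllOfSize r F' → Unique F' → F ⊆ F' → WeaklySat r n ℋ F → WeaklySat r n ℋ' F'
  WeaklySat-extend {r} {F' = F'} step F'-size F'-unique F⊆F'
                   (_ , _ , L , L-unique , L-size , _ , F∪L-complete , L-process) =
    F'-size , F'-unique , filter (_∉? F') L ,
    Unique.filter⁺ _ L-unique , All.filter⁺ _ L-size , All.all-filter _ L , complete ,
    Process-transfer F' step L F⊆F' (λ s∈F' → s∈F') L-process
    where
    complete : ∀ s → ∣ s ∣ ≡ r → s ∈ F' ⊎ s ∈ filter (_∉? F') L
    complete s s-size with s ∈? F'
    ... | yes s∈F' = inj₁ s∈F'
    ... | no  s∉F' = inj₂ ([ ⊥-elim ∘ s∉F' ∘ F⊆F' , (λ s∈L → ∈-filter⁺ (_∉? F') s∈L s∉F') ]′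
                               (F∪L-complete s s-size))

WeaklySat-⨆⁻ : ∀ {r n} ℋ {F : List (Subset n)} → WeaklySat r n [ ⨆ ℋ ] F → WeaklySat r n ℋ F
WeaklySat-⨆⁻ ℋ sat@(F-size , F-unique , _) =
  WeaklySat-extend (λ _ → CopyContaining-⨆⁻ ℋ ∘ Any.singleton⁻) F-size F-unique (λ s∈F → s∈F) sat

disjointCopies : Hypergraph → Hypergraph
disjointCopies X = ⨆ (replicate (suc (vertices X)) X)

AllOfSize-disjointCopies : ∀ {r} X → AllOfSize r (edges X) → AllOfSize r (edges (disjointCopies X))
AllOfSize-disjointCopies X X-size =
  AllOfSize-⨆ (replicate (suc (vertices X)) X) (All.replicate⁺ (suc (vertices X)) X-size)

spareCopies : Hypergraph → ℕ → Hypergraph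
spareCopies X m = disjointCopies X ⊔ hg m []

module _ (X : Hypergraph) (m : ℕ) where

  spareCopy : Fin (suc (vertices X)) → Fin (vertices X) → Fin (vertices (spareCopies X m))
  spareCopy b = (_↑ˡ m) ∘ inCopy X b

  spareCopy-embeds : ∀ b → Embeds X (edges (spareCopies X m)) (spareCopy b)
  spareCopy-embeds b = Embeds-∘ (↑ˡ-embeds _ (hg m [])) (inCopy-embeds X b)

  spareCopy-disjoint : ∀ {b b'} x y → spareCopy b x ≡ spareCopy b' y → b ≡ b'
  spareCopy-disjoint x y eq = inCopy-disjoint X x y (↑ˡ-injective m _ _ eq)

module _ (ℋ : List Hypergraph) (m : ℕ) where

  private
    n : ℕ
    n = vertices (spareCopies (⨆ ℋ) m)
    spare : List (Subset n)
    spare = edges (spareCopies (⨆ ℋ) m)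

  CopyContaining-⨆⁺ : ∀ {G : List (Subset n)} {e} →
                      spare ⊆ G → Completes ℋ G e → CopyContaining (⨆ ℋ) G e
  CopyContaining-⨆⁺ spare⊆G some-copy
    with H , H∈ℋ , φ , φ-inj , φ-edges , φ-covers ← find some-copy
    with b , φ-avoids-b ← avoided-block φ (spareCopy (⨆ ℋ) m) (spareCopy-disjoint (⨆ ℋ) m)
                                        (s≤s (vertices-≤-⨆ H∈ℋ))
    with ψ , ψ-embeds , ψ-covers , _ ← replace-component H∈ℋ (φ-inj , φ-edges) φ-covers
                                         (Embeds-mono spare⊆G (spareCopy-embeds (⨆ ℋ) m b)) φ-avoids-b
    = copy ψ-embeds ψ-covers

  WeaklySat-⨆ : ∀ {r} → All (AllOfSize r ∘ edges) ℋ → {F : List (Subset n)} → WeaklySat r n ℋ F →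
    Σ (List (Subset n)) λ F' →
      WeaklySat r n [ ⨆ ℋ ] F' × length F' ≤ length F + length (edges (disjointCopies (⨆ ℋ)))
  WeaklySat-⨆ {r} ℋ-sizes {F} sat@(F-size , _) =
    F' ,
    WeaklySat-extend (λ F'⊆G → here ∘ CopyContaining-⨆⁺ (there ∘ F'⊆G ∘ spare⊆F'))
                     (All.deduplicate⁺ _≟ₛ_ (All.++⁺ F-size spare-size)) (deduplicate-! _≟ₛ_ (F ++ₗ spare))
                     (∈-deduplicate⁺ _≟ₛ_ ∘ xs⊆xs++ys F spare) sat ,
    (begin
      length F'                              ≤⟨ length-deduplicate _≟ₛ_ (F ++ₗ spare) ⟩
      length (F ++ₗ spare)                   ≡⟨ length-++ F ⟩
      length F + length spare                ≡⟨ cong (length F +_) (length-edges-⊔ Blocks (hg m [])) ⟩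
      length F + (length (edges Blocks) + 0) ≡⟨ cong (length F +_) (+-identityʳ _) ⟩
      length F + length (edges Blocks)       ∎)
    where
    open ≤-Reasoning
    Blocks : Hypergraph
    Blocks = disjointCopies (⨆ ℋ)
    F' : List (Subset n)
    F' = deduplicate _≟ₛ_ (F ++ₗ spare)
    spare-size : AllOfSize r spare
    spare-size = AllOfSize-⊔ Blocks (hg m []) (AllOfSize-disjointCopies (⨆ ℋ) (AllOfSize-⨆ ℋ ℋ-sizes)) []
    spare⊆F' : spare ⊆ F'
    spare⊆F' = ∈-deduplicate⁺ _≟ₛ_ ∘ xs⊆ys++xs spare F

  wsat-⨆-bounds : ∀ {r} → All (AllOfSize r ∘ edges) ℋ →
    ∀ {a b} → IsWsat r n ℋ a → IsWsat r n [ ⨆ ℋ ] b →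
    let C = length (edges (disjointCopies (⨆ ℋ))) in (a ≤ b + C) × (b ≤ a + C)
  wsat-⨆-bounds ℋ-sizes ((Fa , Fa-sat , refl) , a-minimal) ((Fb , Fb-sat , refl) , b-minimal) =
    let (F' , F'-sat , F'-length) = WeaklySat-⨆ ℋ-sizes Fa-sat
    in ≤-trans (a-minimal Fb (WeaklySat-⨆⁻ ℋ Fb-sat)) (m≤m+n _ _) ,
       ≤-trans (b-minimal F' F'-sat) F'-length

proposition2p7 : (r : ℕ) → 1 ≤ r → (ℋ : List Hypergraph) → ℋ ≢ []
    → All (λ H → IsUniform r H × NonEmpty H) ℋ
    → Σ ℕ λ C → Σ ℕ λ N → ∀ n → N ≤ n → ∀ a b
    → IsWsat r n ℋ a → IsWsat r n (⨆ ℋ ∷ []) b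
    → (a ≤ b + C) × (b ≤ a + C)
proposition2p7 r _ ℋ _ ℋ-uniform = C , N , bounds
  where
  C N : ℕ
  C = length (edges (disjointCopies (⨆ ℋ)))
  N = vertices (disjointCopies (⨆ ℋ))
  bounds : ∀ n → N ≤ n → ∀ a b → IsWsat r n ℋ a → IsWsat r n [ ⨆ ℋ ] b → (a ≤ b + C) × (b ≤ a + C)
  bounds n N≤n a b with m , refl ← m≤n⇒∃[o]m+o≡n N≤n =
    wsat-⨆-bounds ℋ m (All.map (proj₁ ∘ proj₁) ℋ-uniform)
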